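{- Let $\mathrm{sort}$ be a sort function satisfying the characteristic property. Let $T$ be a type, $\leq$ a relation on $T$, $\sim$ a binary relation on $\mathrm{list}\,T$, and $xs : \mathrm{list}\,T$. Suppose (i) for all lists $xs, xs', ys, ys'$ of type $\mathrm{list}\,T$, if $xs \sim xs'$ and $ys \sim ys'$ then $(xs \mathbin{+\!\!+} ys) \sim (xs' \mathbin{\land\hspace{ -.45em}\land}_\leq ys')$; (ii) $[x] \sim [x]$ for every $x : T$; (iii) $[] \sim []$. Then $xs \sim \mathrm{sort}_\leq\,xs$.
   Context: Lists: $[]$ is the empty list, $x :: s$ is cons, $[x]$ is the singleton list, $\mathbin{+\!\!+}$ is concatenation. A "relation" $\leq$ on a type $T$ is a function $T \to T \to \mathrm{bool}$. The merge of two lists w.r.t. $\leq$ is defined by $[] \mathbin{\land\hspace{ -.45em}\land}_\leq ys = ys$, $xs \mathbin{\land\hspace{ -.45em}\land}_\leq [] = xs$, and $(x :: xs) \mathbin{\land\hspace{ -.45em}\land}_\leq (y :: ys) = x :: (xs \mathbin{\land\hspace{ -.45em}\land}_\leq (y :: ys))$ if $x \leq y$, and $= y :: ((x :: xs) \mathbin{\land\hspace{ -.45em}\land}_\leq ys)$ otherwise. A sort function $\mathrm{sort}$ assigns to every type $T$ and relation $\leq$ on $T$ a function $\mathrm{sort}_\leq : \mathrm{list}\,T \to \mathrm{list}\,T$. It satisfies the characteristic property if there is a polymorphic function $\mathrm{asort}$ of type $\forall (T\,R : \mathcal{U}), (R \to R \to R) \to (T \to R) \to R \to \mathrm{list}\,T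 \to R$ such that: (1) for all $T$, $\leq$, $xs$: $\mathrm{asort}\,(\mathbin{\land\hspace{ -.45em}\land}_\leq)\,(\lambda x.[x])\,[]\,xs = \mathrm{sort}_\leq\,xs$; (2) for all $T$, $xs$: $\mathrm{asort}\,(\mathbin{+\!\!+})\,(\lambda x.[x])\,[]\,xs = xs$; (3) $\mathrm{asort}$ is relationally parametric: for all types $T_1,T_2$ and relation $\sim_T \subseteq T_1 \times T_2$, all types $R_1,R_2$ and relation $\sim_R \subseteq R_1\times R_2$, all $m_i : R_i \to R_i \to R_i$ with $a_1 \sim_R a_2 \wedge b_1 \sim_R b_2 \Rightarrow m_1\,a_1\,b_1 \sim_R m_2\,a_2\,b_2$, all $s_i : T_i \to R_i$ with $x_1 \sim_T x_2 \Rightarrow s_1\,x_1 \sim_R s_2\,x_2$, all $e_i : R_i$ with $e_1 \sim_R e_2$, and all lists $xs_1 : \mathrm{list}\,T_1$, $xs_2 : \mathrm{list}\,T_2$ of equal length that are pointwise $\sim_T$-related, we have $\mathrm{asort}\,m_1\,s_1\,e_1\,xs_1 \sim_R \mathrm{asort}\,m_2\,s_2\,e_2\,xs_2$. -}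

module Defs where

open import Data.Bool using (Bool; true; false; if_then_else_)
open import Data.List using (List; []; _∷_; [_]; _++_)
open import Data.Product using (Σ)
open import Relation.Binary.PropositionalEquality using (_≡_)
open import Data.List.Relation.Binary.Pointwise using (Pointwise)

Rel : Set → Set
Rel T = T → T → Bool

merge : {T : Set} → Rel T → List T → List T → List T
merge leq []       ys       = ys
merge leq (x ∷ xs) []       = x ∷ xs
merge leq (x ∷ xs) (y ∷ ys) =
  if leq x y then x ∷ merge leq xs (y ∷ ys) else y ∷ merge leq (x ∷ xs) ys

SortFun : Set₁
SortFun = {T : Set} → Rel T → List T → List T

ASortType : Set₁
ASortType = (T R : Set) → (R → R → R) → (T → R) → R → List T → R

Parametric : ASortType → Set₁
Parametric asort =
  (T₁ T₂ : Set) (_∼T_ : T₁ → T₂ → Set)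
  (R₁ R₂ : Set) (_∼R_ : R₁ → R₂ → Set)
  (m₁ : R₁ → R₁ → R₁) (m₂ : R₂ → R₂ → R₂) →
  (∀ {a₁ a₂ b₁ b₂} → a₁ ∼R a₂ → b₁ ∼R b₂ → m₁ a₁ b₁ ∼R m₂ a₂ b₂) →
  (s₁ : T₁ → R₁) (s₂ : T₂ → R₂) →
  (∀ {x₁ x₂} → x₁ ∼T x₂ → s₁ x₁ ∼R s₂ x₂) →
  (e₁ : R₁) (e₂ : R₂) → e₁ ∼R e₂ →
  (xs₁ : List T₁) (xs₂ : List T₂) → Pointwise _∼T_ xs₁ xs₂ →
  asort T₁ R₁ m₁ s₁ e₁ xs₁ ∼R asort T₂ R₂ m₂ s₂ e₂ xs₂

record CharacteristicProperty (sort : SortFun) : Set₁ where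
  field
    asort      : ASortType
    asort-sort : (T : Set) (leq : Rel T) (xs : List T) →
                 asort T (List T) (merge leq) [_] [] xs ≡ sort leq xs
    asort-id   : (T : Set) (xs : List T) →
                 asort T (List T) _++_ [_] [] xs ≡ xs
    asort-param : Parametric asort

-- Instantiate the parametricity of asort at the identity relation on elements
-- and at ∼ on results: the run with (_++_, [_], []) is then ∼-related to the
-- run with (merge ≤, [_], []), and by the characteristic property these two
-- runs compute xs and sort xs.
module Submission where

open import Defs
open import Data.List using (List; []; _∷_; [_]; _++_)
open import Relation.Binary.PropositionalEquality using (_≡_; refl; subst₂)
open import Data.List.Relation.Binary.Pointwise using (Pointwise)
import Data.List.Relation.Binary.Pointwise.Properties as Pointwise

asort-related : {asort : ASortType} → Parametric asort →
  (T R₁ R₂ : Set) (_∼_ : R₁ → R₂ → Set)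
  (m₁ : R₁ → R₁ → R₁) (m₂ : R₂ → R₂ → R₂) →
  (∀ {a₁ a₂ b₁ b₂} → a₁ ∼ a₂ → b₁ ∼ b₂ → m₁ a₁ b₁ ∼ m₂ a₂ b₂) →
  (s₁ : T → R₁) (s₂ : T → R₂) → (∀ x → s₁ x ∼ s₂ x) →
  (e₁ : R₁) (e₂ : R₂) → e₁ ∼ e₂ →
  (xs : List T) → asort T R₁ m₁ s₁ e₁ xs ∼ asort T R₂ m₂ s₂ e₂ xs
asort-related param T R₁ R₂ _∼_ m₁ m₂ m∼ s₁ s₂ s∼ e₁ e₂ e∼ xs =
  param T T _≡_ R₁ R₂ _∼_ m₁ m₂ m∼ s₁ s₂ (λ { refl → s∼ _ }) e₁ e₂ e∼
    xs xs (Pointwise.refl refl)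

lemma3p5 : (sort : SortFun) → CharacteristicProperty sort →
    (T : Set) (leq : Rel T) (_∼_ : List T → List T → Set) (xs : List T) →
    (∀ {as as′ bs bs′ : List T} → as ∼ as′ → bs ∼ bs′ → (as ++ bs) ∼ merge leq as′ bs′) →
    (∀ (x : T) → [ x ] ∼ [ x ]) →
    [] ∼ [] →
    xs ∼ sort leq xs
lemma3p5 sort cp T leq _∼_ xs ++∼merge [x]∼[x] []∼[] =
  subst₂ _∼_ (asort-id T xs) (asort-sort T leq xs)
    (asort-related asort-param T (List T) (List T) _∼_ _++_ (merge leq) ++∼merge
      [_] [_] [x]∼[x] [] [] []∼[] xs)
  where open CharacteristicProperty cp
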